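{- For every integer $p\ge 1$, the class of $p$-complete square-free word-representable graphs is hereditary, i.e. every induced subgraph of a $p$-complete square-free word-representable graph is again $p$-complete square-free word-representable.
   Context: For a word $w$ and a set $S$ of letters, $w_S$ is the word obtained from $w$ by deleting all letters not in $S$. Two distinct letters $x,y$ alternate in $w$ if $w_{\{x,y\}}$ is of the form $xyxy\cdots$ or $yxyx\cdots$ (even or odd length). A simple graph $G=(V,E)$ is word-representable if there is a word $w$ over $V$, containing every vertex, such that distinct $x,y$ alternate in $w$ iff $xy\in E$ ($w$ represents $G$). A square is a factor (block of consecutive letters) of the form $XX$ with $X$ non-empty. A word $w$ contains a $p$-complete square if there is a set $S$ of letters such that $w_S$ contains a square $XX$ with $|X|\ge p$; otherwise $w$ is $p$-complete square-free. A graph $G$ is $p$-complete square-free word-representable if it is represented by some word $w$ that is $p$-complete square-free, where $1\le p\le\lceil |w|/2\rceil$. -}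

module Defs where

open import Data.Nat using (ℕ; _≤_; ⌈_/2⌉)
open import Data.Fin using (Fin; _≟_)
open import Relation.Nullary.Decidable using (⌊_⌋)
open import Data.Bool using (Bool; true; false; _∨_)
open import Data.List using (List; []; _∷_; _++_; length)
open import Data.List.Membership.Propositional using (_∈_)
open import Data.Product using (Σ; ∃; _×_; _,_)
open import Data.Sum using (_⊎_)
open import Relation.Nullary using (¬_)
open import Relation.Binary.PropositionalEquality using (_≡_; _≢_)
open import Function.Bundles using (_⇔_)

record Graph (n : ℕ) : Set₁ where
  field
    Adj    : Fin n → Fin n → Set
    sym    : ∀ {x y} → Adj x y → Adj y x
    irrefl : ∀ {x} → ¬ Adj x x
open Graph public

Word : ℕ → Set
Word n = List (Fin n)

restrict : ∀ {n} → (Fin n → Bool) → Word n → Word n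
restrict S []       = []
restrict S (a ∷ w) with S a
... | true  = a ∷ restrict S w
... | false = restrict S w

pairSet : ∀ {n} → Fin n → Fin n → Fin n → Bool
pairSet x y z = ⌊ z ≟ x ⌋ ∨ ⌊ z ≟ y ⌋

data AltFrom {n : ℕ} (x y : Fin n) : Word n → Set where
  alt-nil  : AltFrom x y []
  alt-cons : ∀ {u} → AltFrom y x u → AltFrom x y (x ∷ u)

Alternate : ∀ {n} → Word n → Fin n → Fin n → Set
Alternate w x y = AltFrom x y (restrict (pairSet x y) w) ⊎ AltFrom y x (restrict (pairSet x y) w)

Represents : ∀ {n} → Word n → Graph n → Set
Represents {n} w G =
  (∀ (v : Fin n) → v ∈ w) ×
  (∀ (x y : Fin n) → x ≢ y → (Alternate w x y ⇔ Adj G x y))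

HasSquareFactor : ∀ {n} → ℕ → Word n → Set
HasSquareFactor {n} p u =
  Σ (Word n) λ a → Σ (Word n) λ X → Σ (Word n) λ b →
    (u ≡ a ++ (X ++ (X ++ b))) × (p ≤ length X)

ContainsCompleteSquare : ∀ {n} → ℕ → Word n → Set
ContainsCompleteSquare {n} p w = Σ (Fin n → Bool) λ S → HasSquareFactor p (restrict S w)

CompleteSquareFree : ∀ {n} → ℕ → Word n → Set
CompleteSquareFree p w = ¬ ContainsCompleteSquare p w

PCSFWordRepresentable : ∀ {n} → ℕ → Graph n → Set
PCSFWordRepresentable {n} p G =
  Σ (Word n) λ w → Represents w G × CompleteSquareFree p w × (1 ≤ p) × (p ≤ ⌈ length w /2⌉)

-- The subgraph of G induced by the (injective) vertex embedding f : Fin m → Fin n.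
induced : ∀ {m n} → Graph n → (Fin m → Fin n) → Graph m
induced G f = record
  { Adj    = λ x y → Adj G (f x) (f y)
  ; sym    = sym G
  ; irrefl = irrefl G
  }

module Submission where

-- Restricting a representing word w of G to the letters in the image of the
-- embedding f, and relabelling along f⁻¹, gives a word representing the
-- induced subgraph: every restriction of the new word to a set S is the image
-- under f of the restriction of w to f[S], so alternation of x, y matches
-- alternation of f x, f y, and any complete square of the new word would be a
-- complete square of w.
--
-- The new word may be too short for the side condition p ≤ ⌈|w|/2⌉. A word of
-- length at most 2p - 1 has no complete square with |X| ≥ p at all, so it then
-- suffices to lengthen the word to exactly 2p - 1 letters. This is possible
-- because appending the letter whose last occurrence is earliest preserves
-- every alternation: each other letter y occurs after it, so w_{x,y} does not
-- end in x and may be extended by x.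

open import Defs hiding (sym)
open import Data.Nat using (ℕ; suc; _+_; _≤_; _<_; _≤′_; ≤′-reflexive; ≤′-step; z≤n; s≤s; ⌈_/2⌉; ⌊_/2⌋; _≤?_)
open import Data.Nat.Properties
  using (≤-trans; ≤-reflexive; ≤-pred; ≰⇒>; <⇒≱; +-suc; +-comm; +-mono-≤; +-monoʳ-≤; m≤m+n; m≤n+m;
         n≤1+n; ⌊n/2⌋+⌈n/2⌉≡n; ⌊n/2⌋≤⌈n/2⌉; n≡⌊n+n/2⌋; ≤⇒≤′; module ≤-Reasoning)
open import Data.Fin using (Fin; _≟_) renaming (zero to fzero)
open import Data.Fin.Properties using (any?)
open import Data.Bool using (Bool; true; false; _∨_; T)
open import Data.Bool.Properties using (∨-comm; ∨-zeroʳ; T-≡)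
open import Data.List using ([]; _∷_; _++_; _∷ʳ_; [_]; length; map; filterᵇ)
open import Data.List.Properties
  using (map-++; length-map; length-++; length-filter; filter-++; filter-≐; ++-identityʳ)
open import Data.List.Membership.Propositional using (_∈_)
open import Data.List.Membership.Propositional.Properties using (∈-++⁺ˡ; ∈-++⁺ʳ; ∈-filter⁺; ∈-filter⁻)
open import Data.List.Relation.Unary.Any using (here; there)
open import Data.Product using (∃; _×_; _,_; proj₁)
open import Data.Sum using (_⊎_; inj₁; inj₂) renaming (map to ⊎-map; swap to ⊎-swap)
open import Function using (_∘_)
open import Function.Definitions using (Injective)
open import Function.Bundles using (_⇔_; mk⇔; Equivalence)
open import Function.Properties.Equivalence using () renaming (refl to ⇔-refl; trans to ⇔-trans)
open import Relation.Nullary using (¬_; Dec; yes; no; contradiction)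
open import Relation.Nullary.Decidable using (⌊_⌋; isYes≗does; does-⇔)
open import Relation.Nullary.Decidable.Core using (T?)
open import Relation.Binary.PropositionalEquality
  using (_≡_; _≢_; refl; sym; trans; cong; cong₂; subst; module ≡-Reasoning)

⌈n/2⌉≤m⇒n≤m+m : {m n : ℕ} → ⌈ n /2⌉ ≤ m → n ≤ m + m
⌈n/2⌉≤m⇒n≤m+m {m} {n} ⌈n/2⌉≤m = begin
  n                     ≡⟨ ⌊n/2⌋+⌈n/2⌉≡n n ⟨
  ⌊ n /2⌋ + ⌈ n /2⌉     ≤⟨ +-mono-≤ (≤-trans (⌊n/2⌋≤⌈n/2⌉ n) ⌈n/2⌉≤m) ⌈n/2⌉≤m ⟩
  m + m                 ∎
  where open ≤-Reasoning

module _ {n : ℕ} where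

  open import Data.List.Membership.DecPropositional (_≟_ {n}) using (_∈?_)

  restrict≡filterᵇ : (S : Fin n → Bool) (w : Word n) → restrict S w ≡ filterᵇ S w
  restrict≡filterᵇ S []      = refl
  restrict≡filterᵇ S (a ∷ w) with S a
  ... | true  = cong (a ∷_) (restrict≡filterᵇ S w)
  ... | false = restrict≡filterᵇ S w

  restrict-++ : (S : Fin n → Bool) (u v : Word n) → restrict S (u ++ v) ≡ restrict S u ++ restrict S v
  restrict-++ S u v
    rewrite restrict≡filterᵇ S (u ++ v) | restrict≡filterᵇ S u | restrict≡filterᵇ S v
    = filter-++ (T? ∘ S) u v

  restrict-cong : {S S′ : Fin n → Bool} → (∀ z → S z ≡ S′ z) → (w : Word n) → restrict S w ≡ restrict S′ w
  restrict-cong {S} {S′} S≗S′ w = begin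
    restrict S w   ≡⟨ restrict≡filterᵇ S w ⟩
    filterᵇ S w    ≡⟨ filter-≐ (T? ∘ S) (T? ∘ S′) (subst T (S≗S′ _) , subst T (sym (S≗S′ _))) w ⟩
    filterᵇ S′ w   ≡⟨ sym (restrict≡filterᵇ S′ w) ⟩
    restrict S′ w  ∎
    where open ≡-Reasoning

  ∈-restrict⁻ : (S : Fin n → Bool) (w : Word n) {z : Fin n} → z ∈ restrict S w → z ∈ w
  ∈-restrict⁻ S w z∈ = proj₁ (∈-filter⁻ (T? ∘ S) (subst (_ ∈_) (restrict≡filterᵇ S w) z∈))

  ∈-restrict⁺ : (S : Fin n → Bool) (w : Word n) {z : Fin n} → z ∈ w → S z ≡ true → z ∈ restrict S w
  ∈-restrict⁺ S w z∈ Sz =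
    subst (_ ∈_) (sym (restrict≡filterᵇ S w)) (∈-filter⁺ (T? ∘ S) z∈ (Equivalence.from T-≡ Sz))

  length-restrict : (S : Fin n → Bool) (w : Word n) → length (restrict S w) ≤ length w
  length-restrict S w =
    subst (λ r → length r ≤ length w) (sym (restrict≡filterᵇ S w)) (length-filter (T? ∘ S) w)

  restrict-∷ʳ-accept : (S : Fin n → Bool) (u : Word n) (z : Fin n) → S z ≡ true →
    restrict S (u ∷ʳ z) ≡ restrict S u ∷ʳ z
  restrict-∷ʳ-accept S u z Sz rewrite restrict-++ S u [ z ] | Sz = refl

  restrict-∷ʳ-reject : (S : Fin n → Bool) (u : Word n) (z : Fin n) → S z ≡ false →
    restrict S (u ∷ʳ z) ≡ restrict S u
  restrict-∷ʳ-reject S u z Sz rewrite restrict-++ S u [ z ] | Sz = ++-identityʳ _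

  pairSet-comm : (x y z : Fin n) → pairSet x y z ≡ pairSet y x z
  pairSet-comm x y z = ∨-comm ⌊ z ≟ x ⌋ ⌊ z ≟ y ⌋

  pairSet-left : (x y : Fin n) → pairSet x y x ≡ true
  pairSet-left x y with x ≟ x
  ... | yes _   = refl
  ... | no x≢x = contradiction refl x≢x

  pairSet-right : (x y : Fin n) → pairSet x y y ≡ true
  pairSet-right x y with y ≟ y
  ... | yes _   = ∨-zeroʳ _
  ... | no y≢y = contradiction refl y≢y

  pairSet-reject : {x y z : Fin n} → z ≢ x → z ≢ y → pairSet x y z ≡ false
  pairSet-reject {x} {y} {z} z≢x z≢y with z ≟ x | z ≟ y
  ... | yes z≡x | _       = contradiction z≡x z≢x
  ... | no _    | yes z≡y = contradiction z≡y z≢y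
  ... | no _    | no _    = refl

  Alternating : Fin n → Fin n → Word n → Set
  Alternating x y r = AltFrom x y r ⊎ AltFrom y x r

  EndsWith : Fin n → Word n → Set
  EndsWith x r = ∃ λ r′ → r ≡ r′ ∷ʳ x

  endsWith⇒∈ : {x : Fin n} {r : Word n} → EndsWith x r → x ∈ r
  endsWith⇒∈ (r′ , refl) = ∈-++⁺ʳ r′ (here refl)

  endsWith-tail : {x y c : Fin n} {r : Word n} → y ∈ r → EndsWith x (c ∷ r) → EndsWith x r
  endsWith-tail ()  ([] , refl)
  endsWith-tail _   (_ ∷ r′ , refl) = r′ , refl

  endsWith-pairSet-tail : {x y : Fin n} (c : Fin n) (u : Word n) → y ∈ u →
    EndsWith x (restrict (pairSet x y) (c ∷ u)) → EndsWith x (restrict (pairSet x y) u)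
  endsWith-pairSet-tail {x} {y} c u y∈u ends with pairSet x y c
  ... | true  = endsWith-tail (∈-restrict⁺ (pairSet x y) u y∈u (pairSet-right x y)) ends
  ... | false = ends

  altFrom-∷ʳ⁻ : {x y z : Fin n} (r : Word n) → AltFrom x y (r ∷ʳ z) → AltFrom x y r
  altFrom-∷ʳ⁻ []      _            = alt-nil
  altFrom-∷ʳ⁻ (_ ∷ r) (alt-cons h) = alt-cons (altFrom-∷ʳ⁻ r h)

  altFrom-uncons : {x y c : Fin n} {u : Word n} → AltFrom x y (c ∷ u) → c ≡ x × AltFrom y x u
  altFrom-uncons (alt-cons h) = refl , h

  altFrom-∷ʳ : {s t : Fin n} (r : Word n) → AltFrom s t r →
    (AltFrom s t (r ∷ʳ s) × (r ≡ [] ⊎ EndsWith t r)) ⊎ (AltFrom s t (r ∷ʳ t) × EndsWith s r)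
  altFrom-∷ʳ []        alt-nil = inj₁ (alt-cons alt-nil , inj₁ refl)
  altFrom-∷ʳ {s} (s ∷ r) (alt-cons h) with altFrom-∷ʳ r h
  ... | inj₁ (h′ , inj₁ refl)       = inj₂ (alt-cons h′ , [] , refl)
  ... | inj₁ (h′ , inj₂ (q , refl)) = inj₂ (alt-cons h′ , s ∷ q , refl)
  ... | inj₂ (h′ , q , refl)        = inj₁ (alt-cons h′ , inj₂ (s ∷ q , refl))

  alternating-∷ʳ : {x y : Fin n} (r : Word n) → ¬ EndsWith x r → Alternating x y r → Alternating x y (r ∷ʳ x)
  alternating-∷ʳ r ¬ends (inj₁ h) with altFrom-∷ʳ r h
  ... | inj₁ (h′ , _)          = inj₁ h′
  ... | inj₂ (_ , ends)        = contradiction ends ¬ends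
  alternating-∷ʳ r ¬ends (inj₂ h) with altFrom-∷ʳ r h
  ... | inj₁ (_ , inj₁ refl)   = inj₁ (alt-cons alt-nil)
  ... | inj₁ (_ , inj₂ ends)   = contradiction ends ¬ends
  ... | inj₂ (h′ , _)          = inj₂ h′

  alternating-∷ʳ⁻ : {x y z : Fin n} (r : Word n) → Alternating x y (r ∷ʳ z) → Alternating x y r
  alternating-∷ʳ⁻ r = ⊎-map (altFrom-∷ʳ⁻ r) (altFrom-∷ʳ⁻ r)

  alternate-sym : (w : Word n) (x y : Fin n) → Alternate w x y → Alternate w y x
  alternate-sym w x y h = subst (Alternating y x) (restrict-cong (pairSet-comm x y) w) (⊎-swap h)

  alternate-sym⇔ : (w : Word n) (x y : Fin n) → Alternate w x y ⇔ Alternate w y x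
  alternate-sym⇔ w x y = mk⇔ (alternate-sym w x y) (alternate-sym w y x)

  Appendable : Word n → Fin n → Set
  Appendable u x = ∀ y → y ∈ u → y ≢ x → ¬ EndsWith x (restrict (pairSet x y) u)

  -- The witness is the letter whose last occurrence comes earliest; the
  -- default letter is only used for the empty word.
  appendable : Fin n → (u : Word n) → ∃ (Appendable u)
  appendable d []      = d , λ _ ()
  appendable d (c ∷ u) with c ∈? u
  ... | yes c∈u = let x , app = appendable d u in x , λ where
    y (here refl) y≢x ends → app y c∈u y≢x (endsWith-pairSet-tail c u c∈u ends)
    y (there y∈u) y≢x ends → app y y∈u y≢x (endsWith-pairSet-tail c u y∈u ends)
  ... | no c∉u = c , λ where
    y (here y≡c)  y≢c _    → contradiction y≡c y≢c
    y (there y∈u) _   ends →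
      c∉u (∈-restrict⁻ (pairSet c y) u (endsWith⇒∈ (endsWith-pairSet-tail c u y∈u ends)))

  alternate-∷ʳ-self : {u : Word n} {x b : Fin n} → Appendable u x → b ∈ u → b ≢ x →
    Alternate (u ∷ʳ x) x b ⇔ Alternate u x b
  alternate-∷ʳ-self {u} {x} {b} app b∈u b≢x
    rewrite restrict-∷ʳ-accept (pairSet x b) u x (pairSet-left x b)
    = mk⇔ (alternating-∷ʳ⁻ _) (alternating-∷ʳ _ (app b b∈u b≢x))

  alternate-∷ʳ : {u : Word n} {x a b : Fin n} → Appendable u x → a ∈ u → b ∈ u → a ≢ b →
    Alternate (u ∷ʳ x) a b ⇔ Alternate u a b
  alternate-∷ʳ {u} {x} {a} {b} app a∈u b∈u a≢b with x ≟ a | x ≟ b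
  ... | yes refl | _        = alternate-∷ʳ-self app b∈u (a≢b ∘ sym)
  ... | no _     | yes refl =
    ⇔-trans (alternate-sym⇔ (u ∷ʳ x) a x) (⇔-trans (alternate-∷ʳ-self app a∈u a≢b) (alternate-sym⇔ u x a))
  ... | no x≢a   | no x≢b
    rewrite restrict-∷ʳ-reject (pairSet a b) u x (pairSet-reject x≢a x≢b)
    = ⇔-refl

  represents-∷ʳ : {H : Graph n} {u : Word n} {x : Fin n} → Represents u H → Appendable u x →
    Represents (u ∷ʳ x) H
  represents-∷ʳ (covers , alt) app =
    (λ v → ∈-++⁺ˡ (covers v)) ,
    λ a b a≢b → ⇔-trans (alternate-∷ʳ app (covers a) (covers b) a≢b) (alt a b a≢b)

  padTo : {H : Graph n} {u : Word n} {k : ℕ} → Fin n → Represents u H → length u ≤′ k →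
    ∃ λ v → Represents v H × length v ≡ k
  padTo d rep (≤′-reflexive refl) = _ , rep , refl
  padTo {H} d rep (≤′-step le) with padTo {H} d rep le
  ... | v , rep-v , refl with appendable d v
  ... | x , app = v ∷ʳ x , represents-∷ʳ {H} rep-v app , trans (length-++ v) (+-comm (length v) 1)

  hasSquareFactor⇒length : {p : ℕ} (u : Word n) → HasSquareFactor p u → p + p ≤ length u
  hasSquareFactor⇒length {p} _ (a , X , b , refl , p≤X) = begin
    p + p                                         ≤⟨ +-mono-≤ p≤X p≤X ⟩
    length X + length X                           ≤⟨ +-monoʳ-≤ (length X) (m≤m+n _ (length b)) ⟩
    length X + (length X + length b)              ≤⟨ m≤n+m _ (length a) ⟩
    length a + (length X + (length X + length b)) ≡⟨ cong (λ k → length a + (length X + k)) (length-++ X) ⟨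
    length a + (length X + length (X ++ b))       ≡⟨ cong (length a +_) (length-++ X) ⟨
    length a + length (X ++ (X ++ b))             ≡⟨ length-++ a ⟨
    length (a ++ (X ++ (X ++ b)))                 ∎
    where open ≤-Reasoning

  completeSquareFree-short : {p : ℕ} (w : Word n) → length w < p + p → CompleteSquareFree p w
  completeSquareFree-short w short (S , square) =
    <⇒≱ short (≤-trans (hasSquareFactor⇒length _ square) (length-restrict S w))

  short⇒PCSFWordRepresentable : (H : Graph n) {u : Word n} (q : ℕ) → Fin n →
    Represents u H → length u ≤ suc (q + q) → PCSFWordRepresentable (suc q) H
  short⇒PCSFWordRepresentable H q d rep short with padTo {H} d rep (≤⇒≤′ short)
  ... | v , rep-v , |v|≡2q+1 =
    v , rep-v , completeSquareFree-short v |v|<2p , s≤s z≤n ,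
    subst (λ k → suc q ≤ ⌈ k /2⌉) (sym |v|≡2q+1) p≤⌈2q+1/2⌉
    where
    |v|<2p : length v < suc q + suc q
    |v|<2p = subst (_< suc q + suc q) (sym |v|≡2q+1) (s≤s (≤-reflexive (sym (+-suc q q))))
    p≤⌈2q+1/2⌉ : suc q ≤ ⌈ suc (q + q) /2⌉
    p≤⌈2q+1/2⌉ = s≤s (≤-reflexive (n≡⌊n+n/2⌋ q))

  completeSquareFree⇒PCSFWordRepresentable : (H : Graph n) {u : Word n} (q : ℕ) → Fin n →
    Represents u H → CompleteSquareFree (suc q) u → PCSFWordRepresentable (suc q) H
  completeSquareFree⇒PCSFWordRepresentable H {u} q d rep csf with suc q ≤? ⌈ length u /2⌉
  ... | yes long = u , rep , csf , s≤s z≤n , long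
  ... | no ¬long =
    short⇒PCSFWordRepresentable H q d rep (≤-trans (⌈n/2⌉≤m⇒n≤m+m (≤-pred (≰⇒> ¬long))) (n≤1+n _))

module _ {m n : ℕ} (f : Fin m → Fin n) where

  altFrom-map : {x y : Fin m} {v : Word m} → AltFrom x y v → AltFrom (f x) (f y) (map f v)
  altFrom-map alt-nil      = alt-nil
  altFrom-map (alt-cons h) = alt-cons (altFrom-map h)

  altFrom-map⁻ : Injective _≡_ _≡_ f → {x y : Fin m} (v : Word m) →
    AltFrom (f x) (f y) (map f v) → AltFrom x y v
  altFrom-map⁻ f-inj []      _            = alt-nil
  altFrom-map⁻ f-inj (z ∷ v) h with altFrom-uncons h
  ... | fz≡fx , h′ with f-inj fz≡fx
  ... | refl = alt-cons (altFrom-map⁻ f-inj v h′)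

  alternating-map : Injective _≡_ _≡_ f → {x y : Fin m} {v : Word m} →
    Alternating x y v ⇔ Alternating (f x) (f y) (map f v)
  alternating-map f-inj {v = v} =
    mk⇔ (⊎-map altFrom-map altFrom-map) (⊎-map (altFrom-map⁻ f-inj v) (altFrom-map⁻ f-inj v))

  hasSquareFactor-map : {p : ℕ} (r : Word m) → HasSquareFactor p r → HasSquareFactor p (map f r)
  hasSquareFactor-map _ (a , X , b , refl , p≤X) =
    map f a , map f X , map f b , map-square , subst (_ ≤_) (sym (length-map f X)) p≤X
    where
    open ≡-Reasoning
    map-square : map f (a ++ (X ++ (X ++ b))) ≡ map f a ++ (map f X ++ (map f X ++ map f b))
    map-square = begin
      map f (a ++ (X ++ (X ++ b)))                  ≡⟨ map-++ f a _ ⟩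
      map f a ++ map f (X ++ (X ++ b))              ≡⟨ cong (map f a ++_) (map-++ f X _) ⟩
      map f a ++ (map f X ++ map f (X ++ b))        ≡⟨ cong (λ t → map f a ++ (map f X ++ t)) (map-++ f X b) ⟩
      map f a ++ (map f X ++ (map f X ++ map f b))  ∎

module Pullback {m n : ℕ} {f : Fin m → Fin n} (f-inj : Injective _≡_ _≡_ f) where

  preimage? : (a : Fin n) → Dec (∃ λ z → f z ≡ a)
  preimage? a = any? λ z → f z ≟ a

  ⌊≟⌋-injective : (z x : Fin m) → ⌊ z ≟ x ⌋ ≡ ⌊ f z ≟ f x ⌋
  ⌊≟⌋-injective z x = begin
    ⌊ z ≟ x ⌋             ≡⟨ isYes≗does (z ≟ x) ⟩
    Dec.does (z ≟ x)      ≡⟨ does-⇔ (mk⇔ (cong f) f-inj) (z ≟ x) (f z ≟ f x) ⟩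
    Dec.does (f z ≟ f x)  ≡⟨ isYes≗does (f z ≟ f x) ⟨
    ⌊ f z ≟ f x ⌋         ∎
    where open ≡-Reasoning

  pullback : Word n → Word m
  pullback []      = []
  pullback (a ∷ w) with preimage? a
  ... | yes (z , _) = z ∷ pullback w
  ... | no _        = pullback w

  imageSet : (Fin m → Bool) → Fin n → Bool
  imageSet S a with preimage? a
  ... | yes (z , _) = S z
  ... | no _        = false

  map-restrict-pullback : (S : Fin m → Bool) (w : Word n) →
    map f (restrict S (pullback w)) ≡ restrict (imageSet S) w
  map-restrict-pullback S []      = refl
  map-restrict-pullback S (a ∷ w) with preimage? a
  ... | no _           = map-restrict-pullback S w
  ... | yes (z , refl) with S z
  ...   | true  = cong (f z ∷_) (map-restrict-pullback S w)
  ...   | false = map-restrict-pullback S w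

  ∈-pullback : {z : Fin m} (w : Word n) → f z ∈ w → z ∈ pullback w
  ∈-pullback {z} (a ∷ w) (here fz≡a) with preimage? a
  ... | yes (z′ , fz′≡a) = here (f-inj (trans fz≡a (sym fz′≡a)))
  ... | no ∄z            = contradiction (z , fz≡a) ∄z
  ∈-pullback (a ∷ w) (there fz∈w) with preimage? a
  ... | yes _ = there (∈-pullback w fz∈w)
  ... | no _  = ∈-pullback w fz∈w

  imageSet-pairSet : (x y : Fin m) (a : Fin n) → imageSet (pairSet x y) a ≡ pairSet (f x) (f y) a
  imageSet-pairSet x y a with preimage? a
  ... | yes (z , refl) = cong₂ _∨_ (⌊≟⌋-injective z x) (⌊≟⌋-injective z y)
  ... | no ∄z = sym (pairSet-reject (λ a≡fx → ∄z (x , sym a≡fx)) (λ a≡fy → ∄z (y , sym a≡fy)))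

  alternate-pullback : (w : Word n) (x y : Fin m) → Alternate (pullback w) x y ⇔ Alternate w (f x) (f y)
  alternate-pullback w x y =
    ⇔-trans (alternating-map f f-inj)
      (subst (λ r → Alternating (f x) (f y) (map f R) ⇔ Alternating (f x) (f y) r) restrict-pullback ⇔-refl)
    where
    R : Word m
    R = restrict (pairSet x y) (pullback w)
    restrict-pullback : map f R ≡ restrict (pairSet (f x) (f y)) w
    restrict-pullback = trans (map-restrict-pullback (pairSet x y) w) (restrict-cong (imageSet-pairSet x y) w)

  represents-pullback : (G : Graph n) (w : Word n) → Represents w G → Represents (pullback w) (induced G f)
  represents-pullback G w (covers , alt) =
    (λ v → ∈-pullback w (covers (f v))) ,
    λ x y x≢y → ⇔-trans (alternate-pullback w x y) (alt (f x) (f y) (x≢y ∘ f-inj))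

  completeSquareFree-pullback : {p : ℕ} (w : Word n) →
    CompleteSquareFree p w → CompleteSquareFree p (pullback w)
  completeSquareFree-pullback {p} w csf (S , square) =
    csf (imageSet S , subst (HasSquareFactor p) (map-restrict-pullback S w) (hasSquareFactor-map f _ square))

mainTheorem2 : (p : ℕ) → 1 ≤ p → {m n : ℕ} → 1 ≤ m → (G : Graph n) →
    (f : Fin m → Fin n) → Injective _≡_ _≡_ f →
    PCSFWordRepresentable p G → PCSFWordRepresentable p (induced G f)
mainTheorem2 (suc q) _ {suc _} _ G f f-inj (w , rep , csf , _) =
  completeSquareFree⇒PCSFWordRepresentable (induced G f) q fzero
    (represents-pullback G w rep) (completeSquareFree-pullback w csf)
  where open Pullback f-inj
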